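{- Let $G=(V,E)$ and the algorithm be as described in the context, with $n=|V|$ and $m=|E|$. Under the distributed adversarial daemon, every execution starting from an arbitrary configuration reaches a stable configuration after at most $3n+2m$ steps.
   Context: Let $G=(V,E)$ be a finite simple undirected graph; each node is a process and $N(i)$ denotes the set of neighbours of $i$. Each process has an identifier from a totally ordered set; identifiers of any two distinct processes at distance at most $2$ are distinct, and comparisons such as $j>i$ between processes are comparisons of their identifiers. Each process $i$ holds variables $m_i\in\{\text{true},\text{false}\}$ and $p_i\in\{null\}\cup N(i)$; a configuration is an assignment of values to all these variables. Define the predicate $PRmarried(i)\equiv \exists j\in N(i): (p_i=j \text{ and } p_j=i)$. The algorithm consists of the following four guarded rules for each process $i$ (a rule is enabled at $i$ if its guard holds; at most one rule is enabled at a process at any time): Update: if $m_i\neq PRmarried(i)$ then $m_i:=PRmarried(i)$. Marriage: if $m_i=PRmarried(i)$ and $p_i=null$ and there is $j\in N(i)$ with $p_j=i$, then $p_i:=j$ (for such a $j$). Seduction: if $m_i=PRmarried(i)$ and $p_i=null$ and $p_k\neq i$ for all $k\in N(i)$ and there is $j\in N(i)$ with $p_j=null$, $j>i$ and $m_j=\text{false}$, then $p_i:=\max\{j\in N(i): p_j=null,\ j>i,\ m_j=\text{false}\}$. Abandonment: if $m_i=PRmarried(i)$ and $p_i=j\neq null$ and $p_j\neq i$ and ($m_j=\text{true}$ or $j\le i$), then $p_i:=null$. A process is eligible if some rule is enabled at it; a configuration is stable if no process is eligible. Under the distributed adversarial daemon, a step from a configuration $C$ consists of an arbitrary nonempty subset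 of the processes eligible in $C$ each executing its enabled rule, all guards and assignments being evaluated in $C$ (simultaneous execution); an execution is a maximal sequence of configurations, starting from an arbitrary configuration, each obtained from the previous one by a step. The execution of a rule by a process is called a move. -}

module Defs where

open import Data.Nat using (ℕ; zero; suc; _+_; _*_; _≤_; _<_; _<ᵇ_)
open import Data.Bool using (Bool; true; false; _∧_)
open import Data.Fin using (Fin; toℕ)
open import Data.List using (List; length; filterᵇ; cartesianProduct; allFin)
open import Data.Maybe using (Maybe; just; nothing)
open import Data.Product using (Σ; ∃; _×_; _,_; proj₁; proj₂)
open import Data.Sum using (_⊎_)
open import Relation.Binary.PropositionalEquality using (_≡_; _≢_)
open import Relation.Nullary using (¬_)

-- Processes are the elements of Fin n.  The graph is given by a Boolean
-- adjacency function; j ∈ N(i) iff Adj adj i j.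
Adj : {n : ℕ} → (Fin n → Fin n → Bool) → Fin n → Fin n → Set
Adj adj i j = adj i j ≡ true

SimpleGraph : {n : ℕ} → (Fin n → Fin n → Bool) → Set
SimpleGraph {n} adj =
  (∀ (i j : Fin n) → adj i j ≡ adj j i) × (∀ (i : Fin n) → adj i i ≡ false)

numEdges : {n : ℕ} → (Fin n → Fin n → Bool) → ℕ
numEdges {n} adj =
  length (filterᵇ (λ ij → (toℕ (proj₁ ij) <ᵇ toℕ (proj₂ ij)) ∧ adj (proj₁ ij) (proj₂ ij))
                  (cartesianProduct (allFin n) (allFin n)))

-- identifiers (in ℕ, a totally ordered set); distinct processes at
-- distance at most 2 have distinct identifiers
LocallyDistinctIds : {n : ℕ} → (Fin n → Fin n → Bool) → (Fin n → ℕ) → Set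
LocallyDistinctIds {n} adj ident =
  (∀ (i j : Fin n) → Adj adj i j → ident i ≢ ident j) ×
  (∀ (i k j : Fin n) → Adj adj i k → Adj adj k j → i ≢ j → ident i ≢ ident j)

-- a configuration: m_i and p_i for every process (p_i = nothing means null)
record Config (n : ℕ) : Set where
  constructor config
  field
    mv : Fin n → Bool
    pv : Fin n → Maybe (Fin n)
open Config public

WellFormed : {n : ℕ} → (Fin n → Fin n → Bool) → Config n → Set
WellFormed {n} adj C = ∀ (i j : Fin n) → pv C i ≡ just j → Adj adj i j

module Algorithm {n : ℕ} (adj : Fin n → Fin n → Bool) (ident : Fin n → ℕ) where

  PRmarried : Config n → Fin n → Set
  PRmarried C i = ∃ λ j → Adj adj i j × pv C i ≡ just j × pv C j ≡ just i

  Agree : Config n → Fin n → Set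
  Agree C i = (mv C i ≡ true → PRmarried C i) × (PRmarried C i → mv C i ≡ true)

  -- each rule as a relation between C, i and the new local state (m_i' , p_i')
  UpdateMove : Config n → Fin n → Bool → Maybe (Fin n) → Set
  UpdateMove C i b q =
    ¬ Agree C i × ((b ≡ true → PRmarried C i) × (PRmarried C i → b ≡ true)) × q ≡ pv C i

  MarriageMove : Config n → Fin n → Bool → Maybe (Fin n) → Set
  MarriageMove C i b q =
    Agree C i × pv C i ≡ nothing × b ≡ mv C i ×
    (∃ λ j → Adj adj i j × pv C j ≡ just i × q ≡ just j)

  Candidate : Config n → Fin n → Fin n → Set
  Candidate C i j = Adj adj i j × pv C j ≡ nothing × ident i < ident j × mv C j ≡ false

  SeductionMove : Config n → Fin n → Bool → Maybe (Fin n) → Set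
  SeductionMove C i b q =
    Agree C i × pv C i ≡ nothing × (∀ k → Adj adj i k → pv C k ≢ just i) × b ≡ mv C i ×
    (∃ λ j → Candidate C i j × (∀ k → Candidate C i k → ident k ≤ ident j) × q ≡ just j)

  AbandonmentMove : Config n → Fin n → Bool → Maybe (Fin n) → Set
  AbandonmentMove C i b q =
    Agree C i × b ≡ mv C i × q ≡ nothing ×
    (∃ λ j → pv C i ≡ just j × pv C j ≢ just i × (mv C j ≡ true ⊎ ident j ≤ ident i))

  Move : Config n → Fin n → Bool → Maybe (Fin n) → Set
  Move C i b q =
    UpdateMove C i b q ⊎ MarriageMove C i b q ⊎ SeductionMove C i b q ⊎ AbandonmentMove C i b q

  Eligible : Config n → Fin n → Set
  Eligible C i = Σ Bool λ b → Σ (Maybe (Fin n)) λ q → Move C i b q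

  Stable : Config n → Set
  Stable C = ∀ i → ¬ Eligible C i

  -- distributed daemon step: a nonempty set S of (eligible) processes moves
  -- simultaneously, all guards evaluated in C; the others keep their state
  Step : Config n → Config n → Set
  Step C C' = Σ (Fin n → Bool) λ S →
    (∃ λ i → S i ≡ true) ×
    (∀ i → S i ≡ true → Move C i (mv C' i) (pv C' i)) ×
    (∀ i → S i ≡ false → mv C' i ≡ mv C i × pv C' i ≡ pv C i)

  SameConfig : Config n → Config n → Set
  SameConfig C C' = ∀ i → mv C' i ≡ mv C i × pv C' i ≡ pv C i

  -- an execution (maximal sequence of configurations), encoded as an
  -- infinite sequence that stutters once (and only once) a stable
  -- configuration is reached
  IsExecution : (ℕ → Config n) → Set
  IsExecution e = WellFormed adj (e 0) ×
    (∀ t → Step (e t) (e (suc t)) ⊎ (Stable (e t) × SameConfig (e t) (e (suc t))))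

-- Every process k contributes flagPot ≤ 2, a bound on the
-- Update moves it can still make (a married process stays married), and
-- pointerPot ≤ 1; every edge contributes edgePot ≤ 2.  So the potential is at
-- most 3n + 2m.  No step raises a local potential, and every kind of move lowers
-- one: an Update corrects a flag, Marriage and Seduction make a pointer along an
-- edge appear, and an Abandonment either drops a charged pointer or leaves a
-- married higher neighbour.  Each of these local claims is a finite check over
-- the Booleans describing the local state before and after the step.

module Submission where

open import Defs
open import Data.Bool using (Bool; true; false; _∧_)
open import Data.Bool.Properties using (_≟_; T-∧; T-≡)
open import Data.Fin using (Fin; toℕ)
open import Data.Fin.Properties using (any?; toℕ-injective) renaming (_≟_ to _≟ᶠ_)
open import Data.List using (List; []; _∷_; length; map; filterᵇ; cartesianProduct; allFin)
open import Data.List.Membership.Propositional using (_∈_)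
open import Data.List.Membership.Propositional.Properties
  using (∈-filter⁺; ∈-cartesianProduct⁺; ∈-allFin)
open import Data.List.Properties using (length-tabulate)
open import Data.List.Relation.Unary.Any using (here; there)
open import Data.Maybe using (Maybe; just; nothing)
open import Data.Maybe.Properties using (just-injective) renaming (≡-dec to ≡-decᵐ)
open import Data.Nat using (ℕ; zero; suc; _+_; _*_; _≤_; _<_; _<ᵇ_; z≤n; s≤s)
open import Data.Nat.Induction using (<-wellFounded)
open import Data.Nat.ListAction using (sum)
open import Data.Nat.Properties
  using (_≤?_; _<?_; <-cmp; ≤-refl; ≤-trans; ≤⇒≯; <⇒≯; <⇒≢; <⇒≤; <⇒<ᵇ; *-suc;
         +-mono-≤; +-mono-<-≤; +-mono-≤-<)
open import Data.Product using (∃; _×_; _,_; proj₁; proj₂)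
open import Data.Sum using (_⊎_; inj₁; inj₂)
open import Data.Vec using (Vec; []; _∷_)
open import Function using (_∘_)
open import Function.Bundles using (Equivalence)
open import Induction.WellFounded using (Acc; acc)
open import Relation.Binary using (tri<; tri≈; tri>)
open import Relation.Binary.PropositionalEquality
  using (_≡_; _≢_; refl; sym; trans; cong; subst; subst₂)
open import Relation.Nullary
  using (¬_; Dec; yes; no; does; contradiction; ¬?; _×-dec_; _→-dec_; _⊎-dec_)
open import Relation.Nullary.Decidable using (map′; toWitness; dec-true; dec-false)

reaches-within-potential : (Φ : ℕ → ℕ) (Done : ℕ → Set) →
  (∀ t → Done t ⊎ Φ (suc t) < Φ t) → ∃ λ t → t ≤ Φ 0 × Done t
reaches-within-potential Φ Done step = go Φ Done step (<-wellFounded (Φ 0))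
  where
  go : (Φ : ℕ → ℕ) (Done : ℕ → Set) → (∀ t → Done t ⊎ Φ (suc t) < Φ t) →
       Acc _<_ (Φ 0) → ∃ λ t → t ≤ Φ 0 × Done t
  go Φ Done step (acc smaller) with step 0
  ... | inj₁ done = 0 , z≤n , done
  ... | inj₂ Φ₁<Φ₀ with go (Φ ∘ suc) (Done ∘ suc) (step ∘ suc) (smaller Φ₁<Φ₀)
  ...   | t , t≤Φ₁ , done = suc t , ≤-trans (s≤s t≤Φ₁) Φ₁<Φ₀ , done

module _ {A : Set} where

  sum-map-mono : (f g : A → ℕ) (xs : List A) → (∀ x → f x ≤ g x) →
                 sum (map f xs) ≤ sum (map g xs)
  sum-map-mono f g []       f≤g = z≤n
  sum-map-mono f g (x ∷ xs) f≤g = +-mono-≤ (f≤g x) (sum-map-mono f g xs f≤g)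

  sum-map-mono-< : (f g : A → ℕ) (xs : List A) → (∀ x → f x ≤ g x) →
                   ∀ {y} → y ∈ xs → f y < g y → sum (map f xs) < sum (map g xs)
  sum-map-mono-< f g (x ∷ xs) f≤g (here refl) fy<gy =
    +-mono-<-≤ fy<gy (sum-map-mono f g xs f≤g)
  sum-map-mono-< f g (x ∷ xs) f≤g (there y∈xs) fy<gy =
    +-mono-≤-< (f≤g x) (sum-map-mono-< f g xs f≤g y∈xs fy<gy)

  sum-map-≤-* : (f : A → ℕ) (c : ℕ) (xs : List A) → (∀ x → f x ≤ c) →
                sum (map f xs) ≤ c * length xs
  sum-map-≤-* f c []       f≤c = z≤n
  sum-map-≤-* f c (x ∷ xs) f≤c =
    subst (sum (map f (x ∷ xs)) ≤_) (sym (*-suc c (length xs)))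
          (+-mono-≤ (f≤c x) (sum-map-≤-* f c xs f≤c))

≡nothing⇒≢just : {A : Set} {p : Maybe A} {x : A} → p ≡ nothing → p ≢ just x
≡nothing⇒≢just refl ()

witness : {A : Set} (a? : Dec A) → does a? ≡ true → A
witness (yes a) _ = a
witness (no _)  ()

all-Vec-Bool? : ∀ {k} {P : Vec Bool k → Set} → (∀ v → Dec (P v)) → Dec (∀ v → P v)
all-Vec-Bool? {zero}  P? = map′ (λ p → λ { [] → p }) (λ p → p []) (P? [])
all-Vec-Bool? {suc k} P? =
  map′ (λ (pt , pf) → λ { (true ∷ v) → pt v ; (false ∷ v) → pf v })
       (λ p → p ∘ (true ∷_) , p ∘ (false ∷_))
       (all-Vec-Bool? (P? ∘ (true ∷_)) ×-dec all-Vec-Bool? (P? ∘ (false ∷_)))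

flagPot : (married flag : Bool) → ℕ
flagPot true  true  = 0
flagPot true  false = 1
flagPot false false = 1
flagPot false true  = 2

pointerPot : (married towardsLower targetMarried targetFlag : Bool) → ℕ
pointerPot true  _     _     _     = 0
pointerPot false true  _     _     = 1
pointerPot false false true  _     = 0
pointerPot false false false true  = 1
pointerPot false false false false = 0

edgePot : (lowToHigh highToLow lowMarried highMarried highFlag : Bool) → ℕ
edgePot true  true  _     _     _     = 0
edgePot true  false _     true  _     = 1
edgePot true  false _     false false = 1
edgePot true  false _     false true  = 2
edgePot false true  _     _     _     = 2
edgePot false false false false _     = 2
edgePot false false false true  _     = 0
edgePot false false true  _     _     = 0

flagPot≤2 : ∀ M m → flagPot M m ≤ 2
flagPot≤2 true  true  = z≤n
flagPot≤2 true  false = s≤s z≤n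
flagPot≤2 false false = s≤s z≤n
flagPot≤2 false true  = ≤-refl

pointerPot≤1 : ∀ M x Mj mj → pointerPot M x Mj mj ≤ 1
pointerPot≤1 true  _     _     _     = z≤n
pointerPot≤1 false true  _     _     = ≤-refl
pointerPot≤1 false false true  _     = z≤n
pointerPot≤1 false false false true  = ≤-refl
pointerPot≤1 false false false false = z≤n

pointerPot-idle : ∀ M Mj → pointerPot M false Mj false ≡ 0
pointerPot-idle true  _     = refl
pointerPot-idle false true  = refl
pointerPot-idle false false = refl

edgePot≤2 : ∀ a b Ml Mh mh → edgePot a b Ml Mh mh ≤ 2
edgePot≤2 true  true  _     _     _     = z≤n
edgePot≤2 true  false _     true  _     = s≤s z≤n
edgePot≤2 true  false _     false false = s≤s z≤n
edgePot≤2 true  false _     false true  = ≤-refl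
edgePot≤2 false true  _     _     _     = ≤-refl
edgePot≤2 false false false false _     = ≤-refl
edgePot≤2 false false false true  _     = z≤n
edgePot≤2 false false true  _     _     = z≤n

-- Unprimed variables describe the local state before a step, primed ones after it.

FlagClaim : Vec Bool 4 → Set
FlagClaim (M ∷ m ∷ M' ∷ m' ∷ []) =
  (M ≡ true → M' ≡ true) → m' ≡ m ⊎ m' ≡ M →
  flagPot M' m' ≤ flagPot M m × (m' ≢ m → flagPot M' m' < flagPot M m)

flagClaim? : ∀ v → Dec (FlagClaim v)
flagClaim? (M ∷ m ∷ M' ∷ m' ∷ []) =
  (M ≟ true →-dec M' ≟ true) →-dec (m' ≟ m ⊎-dec m' ≟ M) →-dec
  flagPot M' m' ≤? flagPot M m ×-dec (¬? (m' ≟ m) →-dec flagPot M' m' <? flagPot M m)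

flagPot-step : ∀ M m M' m' → FlagClaim (M ∷ m ∷ M' ∷ m' ∷ [])
flagPot-step M m M' m' = toWitness {a? = all-Vec-Bool? flagClaim?} _ (M ∷ m ∷ M' ∷ m' ∷ [])

PointerClaim : Vec Bool 7 → Set
PointerClaim (M ∷ x ∷ Mj ∷ mj ∷ M' ∷ Mj' ∷ mj' ∷ []) =
  (M ≡ true → M' ≡ true) → (Mj ≡ true → Mj' ≡ true) → (Mj' ≡ false → mj' ≡ true → mj ≡ true) →
  pointerPot M' x Mj' mj' ≤ pointerPot M x Mj mj

pointerClaim? : ∀ v → Dec (PointerClaim v)
pointerClaim? (M ∷ x ∷ Mj ∷ mj ∷ M' ∷ Mj' ∷ mj' ∷ []) =
  (M ≟ true →-dec M' ≟ true) →-dec (Mj ≟ true →-dec Mj' ≟ true) →-dec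
  (Mj' ≟ false →-dec mj' ≟ true →-dec mj ≟ true) →-dec
  pointerPot M' x Mj' mj' ≤? pointerPot M x Mj mj

pointerPot-step : ∀ M x Mj mj M' Mj' mj' → PointerClaim (M ∷ x ∷ Mj ∷ mj ∷ M' ∷ Mj' ∷ mj' ∷ [])
pointerPot-step M x Mj mj M' Mj' mj' =
  toWitness {a? = all-Vec-Bool? pointerClaim?} _ (M ∷ x ∷ Mj ∷ mj ∷ M' ∷ Mj' ∷ mj' ∷ [])

EdgeProgress : (a b Mh a' b' : Bool) → Set
EdgeProgress a b Mh a' b' =
  a ≡ false × a' ≡ true ⊎ a ≡ true × a' ≡ false × Mh ≡ true ⊎ b ≡ false × b' ≡ true

EdgeClaim : Vec Bool 10 → Set
EdgeClaim (a ∷ b ∷ Ml ∷ Mh ∷ mh ∷ a' ∷ b' ∷ Ml' ∷ Mh' ∷ mh' ∷ []) =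
  (Ml ≡ true → Ml' ≡ true) → (Mh ≡ true → Mh' ≡ true) → (Mh' ≡ false → mh' ≡ true → mh ≡ true) →
  (a ≡ false → a' ≡ true → Ml ≡ false × (b ≡ true ⊎ Mh ≡ false × mh ≡ false)) →
  (a ≡ true → a' ≡ false → b ≡ false × mh ≡ true) →
  (b ≡ false → b' ≡ true → a ≡ true × mh ≡ false) →
  (b ≡ true → b' ≡ false → a ≡ false × mh ≡ false) →
  edgePot a' b' Ml' Mh' mh' ≤ edgePot a b Ml Mh mh ×
  (EdgeProgress a b Mh a' b' → edgePot a' b' Ml' Mh' mh' < edgePot a b Ml Mh mh)

edgeClaim? : ∀ v → Dec (EdgeClaim v)
edgeClaim? (a ∷ b ∷ Ml ∷ Mh ∷ mh ∷ a' ∷ b' ∷ Ml' ∷ Mh' ∷ mh' ∷ []) =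
  (Ml ≟ true →-dec Ml' ≟ true) →-dec (Mh ≟ true →-dec Mh' ≟ true) →-dec
  (Mh' ≟ false →-dec mh' ≟ true →-dec mh ≟ true) →-dec
  (a ≟ false →-dec a' ≟ true →-dec
    Ml ≟ false ×-dec (b ≟ true ⊎-dec Mh ≟ false ×-dec mh ≟ false)) →-dec
  (a ≟ true →-dec a' ≟ false →-dec b ≟ false ×-dec mh ≟ true) →-dec
  (b ≟ false →-dec b' ≟ true →-dec a ≟ true ×-dec mh ≟ false) →-dec
  (b ≟ true →-dec b' ≟ false →-dec a ≟ false ×-dec mh ≟ false) →-dec
  edgePot a' b' Ml' Mh' mh' ≤? edgePot a b Ml Mh mh ×-dec
  ((a ≟ false ×-dec a' ≟ true ⊎-dec a ≟ true ×-dec a' ≟ false ×-dec Mh ≟ true ⊎-dec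
    b ≟ false ×-dec b' ≟ true) →-dec edgePot a' b' Ml' Mh' mh' <? edgePot a b Ml Mh mh)

edgePot-step : ∀ a b Ml Mh mh a' b' Ml' Mh' mh' →
               EdgeClaim (a ∷ b ∷ Ml ∷ Mh ∷ mh ∷ a' ∷ b' ∷ Ml' ∷ Mh' ∷ mh' ∷ [])
edgePot-step a b Ml Mh mh a' b' Ml' Mh' mh' =
  toWitness {a? = all-Vec-Bool? edgeClaim?} _
            (a ∷ b ∷ Ml ∷ Mh ∷ mh ∷ a' ∷ b' ∷ Ml' ∷ Mh' ∷ mh' ∷ [])

module Matching {n : ℕ} (adj : Fin n → Fin n → Bool) (ident : Fin n → ℕ) where
  open Algorithm adj ident

  _≟ᵖ_ : (p q : Maybe (Fin n)) → Dec (p ≡ q)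
  _≟ᵖ_ = ≡-decᵐ _≟ᶠ_

  points : Config n → Fin n → Fin n → Bool
  points D i j = does (pv D i ≟ᵖ just j)

  married? : ∀ D i → Dec (PRmarried D i)
  married? D i = any? λ j → adj i j ≟ true ×-dec pv D i ≟ᵖ just j ×-dec pv D j ≟ᵖ just i

  married : Config n → Fin n → Bool
  married D i = does (married? D i)

  module _ (D : Config n) (i : Fin n) where

    PRmarried⇒married : PRmarried D i → married D i ≡ true
    PRmarried⇒married = dec-true (married? D i)

    married⇒PRmarried : married D i ≡ true → PRmarried D i
    married⇒PRmarried = witness (married? D i)

    unpointing⇒unmarried : pv D i ≡ nothing → married D i ≡ false
    unpointing⇒unmarried pi≡∅ = dec-false (married? D i) λ (_ , _ , pi≡j , _) →
      contradiction pi≡j (≡nothing⇒≢just pi≡∅)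

    one-sided⇒unmarried : ∀ {j} → pv D i ≡ just j → pv D j ≢ just i → married D i ≡ false
    one-sided⇒unmarried pi≡j pj≢i = dec-false (married? D i) λ (k , _ , pi≡k , pk≡i) →
      pj≢i (subst (λ x → pv D x ≡ just i) (just-injective (trans (sym pi≡k) pi≡j)) pk≡i)

    reflects-married : (b : Bool) → (b ≡ true → PRmarried D i) → (PRmarried D i → b ≡ true) →
                       b ≡ married D i
    reflects-married true  to _    = sym (PRmarried⇒married (to refl))
    reflects-married false _  from =
      sym (dec-false (married? D i) λ pr → contradiction (from pr) λ ())

    agree⇒flag≡married : Agree D i → mv D i ≡ married D i
    agree⇒flag≡married (to , from) = reflects-married (mv D i) to from

    disagree⇒flag≢married : ¬ Agree D i → mv D i ≢ married D i
    disagree⇒flag≢married ¬agree mi≡Mi = ¬agree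
      ( (λ mi → married⇒PRmarried (trans (sym mi≡Mi) mi))
      , (λ pr → trans mi≡Mi (PRmarried⇒married pr)))

  module _ (D : Config n) (i j : Fin n) where

    points⇒≡just : points D i j ≡ true → pv D i ≡ just j
    points⇒≡just = witness (pv D i ≟ᵖ just j)

    ≡just⇒points : pv D i ≡ just j → points D i j ≡ true
    ≡just⇒points = dec-true (pv D i ≟ᵖ just j)

    ¬points⇒≢just : points D i j ≡ false → pv D i ≢ just j
    ¬points⇒≢just a≡f pi≡j = contradiction (trans (sym a≡f) (≡just⇒points pi≡j)) λ ()

    ≢just⇒¬points : pv D i ≢ just j → points D i j ≡ false
    ≢just⇒¬points = dec-false (pv D i ≟ᵖ just j)

  flagPotAt : Config n → Fin n → ℕ
  flagPotAt D k = flagPot (married D k) (mv D k)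

  pointerPotVia : Config n → Fin n → Maybe (Fin n) → ℕ
  pointerPotVia D k nothing  = 0
  pointerPotVia D k (just j) =
    pointerPot (married D k) (does (ident j <? ident k)) (married D j) (mv D j)

  pointerPotAt : Config n → Fin n → ℕ
  pointerPotAt D k = pointerPotVia D k (pv D k)

  nodePot : Config n → Fin n → ℕ
  nodePot D k = flagPotAt D k + pointerPotAt D k

  edgePotAt : Config n → Fin n → Fin n → ℕ
  edgePotAt D lo hi =
    edgePot (points D lo hi) (points D hi lo) (married D lo) (married D hi) (mv D hi)

  orientedEdgePot : Config n → Fin n × Fin n → ℕ
  orientedEdgePot D (x , y) with <-cmp (ident x) (ident y)
  ... | tri< _ _ _ = edgePotAt D x y
  ... | tri≈ _ _ _ = 0  -- never reached on edges: neighbours have distinct identifiers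
  ... | tri> _ _ _ = edgePotAt D y x

  edges : List (Fin n × Fin n)
  edges = filterᵇ (λ ij → (toℕ (proj₁ ij) <ᵇ toℕ (proj₂ ij)) ∧ adj (proj₁ ij) (proj₂ ij))
                  (cartesianProduct (allFin n) (allFin n))

  potential : Config n → ℕ
  potential D = sum (map (nodePot D) (allFin n)) + sum (map (orientedEdgePot D) edges)

  nodePot≤3 : ∀ D k → nodePot D k ≤ 3
  nodePot≤3 D k = +-mono-≤ (flagPot≤2 (married D k) (mv D k)) (pointerPotVia≤1 (pv D k))
    where
    pointerPotVia≤1 : ∀ q → pointerPotVia D k q ≤ 1
    pointerPotVia≤1 nothing  = z≤n
    pointerPotVia≤1 (just j) = pointerPot≤1 _ _ _ _

  orientedEdgePot≤2 : ∀ D p → orientedEdgePot D p ≤ 2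
  orientedEdgePot≤2 D (x , y) with <-cmp (ident x) (ident y)
  ... | tri< _ _ _ = edgePot≤2 _ _ _ _ _
  ... | tri≈ _ _ _ = z≤n
  ... | tri> _ _ _ = edgePot≤2 _ _ _ _ _

  potential≤ : ∀ D → potential D ≤ 3 * n + 2 * numEdges adj
  potential≤ D = +-mono-≤
    (subst (λ l → sum (map (nodePot D) (allFin n)) ≤ 3 * l) (length-tabulate {n = n} (λ k → k))
           (sum-map-≤-* (nodePot D) 3 (allFin n) (nodePot≤3 D)))
    (sum-map-≤-* (orientedEdgePot D) 2 edges (orientedEdgePot≤2 D))

  module _ (D : Config n) {k j : Fin n} (pk≡j : pv D k ≡ just j) where

    pointerPotAt-just : pointerPotAt D k ≡
                        pointerPot (married D k) (does (ident j <? ident k)) (married D j) (mv D j)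
    pointerPotAt-just = cong (pointerPotVia D k) pk≡j

    pointerPotAt-idle : ident k ≤ ident j → mv D j ≡ false → pointerPotAt D k ≡ 0
    pointerPotAt-idle k≤j mj≡f
      rewrite pointerPotAt-just | dec-false (ident j <? ident k) (≤⇒≯ k≤j) | mj≡f =
      pointerPot-idle (married D k) (married D j)

    pointerPotAt-towardsLower : married D k ≡ false → ident j < ident k → pointerPotAt D k ≡ 1
    pointerPotAt-towardsLower Mk≡f j<k
      rewrite pointerPotAt-just | Mk≡f | dec-true (ident j <? ident k) j<k = refl

    pointerPotAt-towardsFlagged : married D k ≡ false → ident k ≤ ident j →
                                  married D j ≡ false → mv D j ≡ true → pointerPotAt D k ≡ 1
    pointerPotAt-towardsFlagged Mk≡f k≤j Mj≡f mj≡t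
      rewrite pointerPotAt-just | Mk≡f | dec-false (ident j <? ident k) (≤⇒≯ k≤j) | Mj≡f | mj≡t
      = refl

  pointerPotAt-married : ∀ D k → married D k ≡ true → pointerPotAt D k ≡ 0
  pointerPotAt-married D k Mk≡t = via (pv D k)
    where
    via : ∀ q → pointerPotVia D k q ≡ 0
    via nothing  = refl
    via (just j) = cong (λ M → pointerPot M (does (ident j <? ident k)) (married D j) (mv D j)) Mk≡t

  orientedEdgePot-< : ∀ D {x y} → ident x < ident y → orientedEdgePot D (x , y) ≡ edgePotAt D x y
  orientedEdgePot-< D {x} {y} x<y with <-cmp (ident x) (ident y)
  ... | tri< _ _ _    = refl
  ... | tri≈ x≮y _ _ = contradiction x<y x≮y
  ... | tri> x≮y _ _ = contradiction x<y x≮y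

  orientedEdgePot-> : ∀ D {x y} → ident y < ident x → orientedEdgePot D (x , y) ≡ edgePotAt D y x
  orientedEdgePot-> D {x} {y} y<x with <-cmp (ident x) (ident y)
  ... | tri< _ _ y≮x = contradiction y<x y≮x
  ... | tri≈ _ _ y≮x = contradiction y<x y≮x
  ... | tri> _ _ _    = refl

  ∈-edges : ∀ {x y} → toℕ x < toℕ y → Adj adj x y → (x , y) ∈ edges
  ∈-edges {x} {y} x<ₙy adj-xy =
    ∈-filter⁺ _ (∈-cartesianProduct⁺ (∈-allFin x) (∈-allFin y))
              (Equivalence.from T-∧ (<⇒<ᵇ x<ₙy , Equivalence.from T-≡ adj-xy))

  edge-listed : (∀ i j → adj i j ≡ adj j i) → ∀ {lo hi} → Adj adj lo hi → ident lo < ident hi →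
                ∃ λ p → p ∈ edges × (∀ D → orientedEdgePot D p ≡ edgePotAt D lo hi)
  edge-listed symmetric {lo} {hi} adj-lh lo<hi with <-cmp (toℕ lo) (toℕ hi)
  ... | tri< lo<ₙhi _ _ = (lo , hi) , ∈-edges lo<ₙhi adj-lh , λ D → orientedEdgePot-< D lo<hi
  ... | tri≈ _ lo≡ₙhi _ = contradiction (cong ident (toℕ-injective lo≡ₙhi)) (<⇒≢ lo<hi)
  ... | tri> _ _ hi<ₙlo = (hi , lo) , ∈-edges hi<ₙlo (trans (symmetric hi lo) adj-lh) ,
                          λ D → orientedEdgePot-> D lo<hi

  Transition : Config n → Config n → Set
  Transition C C' = ∀ k → (mv C' k ≡ mv C k × pv C' k ≡ pv C k) ⊎ Move C k (mv C' k) (pv C' k)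

  step⇒transition : ∀ {C C'} → Step C C' → Transition C C'
  step⇒transition (S , _ , moves , stays) k with S k in Sk
  ... | true  = inj₂ (moves k Sk)
  ... | false = inj₁ (stays k Sk)

  step-preserves-wellFormed : ∀ {C C'} → Step C C' → WellFormed adj C → WellFormed adj C'
  step-preserves-wellFormed step wf i j pi'≡j with step⇒transition step i
  ... | inj₁ (_ , pi'≡pi) = wf i j (trans (sym pi'≡pi) pi'≡j)
  ... | inj₂ (inj₁ (_ , _ , pi'≡pi)) = wf i j (trans (sym pi'≡pi) pi'≡j)
  ... | inj₂ (inj₂ (inj₁ (_ , _ , _ , k , adj-ik , _ , pi'≡k))) =
    subst (Adj adj i) (just-injective (trans (sym pi'≡k) pi'≡j)) adj-ik
  ... | inj₂ (inj₂ (inj₂ (inj₁ (_ , _ , _ , _ , k , (adj-ik , _) , _ , pi'≡k)))) =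
    subst (Adj adj i) (just-injective (trans (sym pi'≡k) pi'≡j)) adj-ik
  ... | inj₂ (inj₂ (inj₂ (inj₂ (_ , _ , pi'≡∅ , _)))) = contradiction pi'≡j (≡nothing⇒≢just pi'≡∅)

  module StepFacts {C C' : Config n} (transition : Transition C C') where

    PointerMove : Fin n → Set
    PointerMove k = MarriageMove C k (mv C' k) (pv C' k)
                  ⊎ SeductionMove C k (mv C' k) (pv C' k)
                  ⊎ AbandonmentMove C k (mv C' k) (pv C' k)

    pointer-moved : ∀ {k} → pv C' k ≢ pv C k → PointerMove k
    pointer-moved {k} pk'≢pk with transition k
    ... | inj₁ (_ , pk'≡pk)             = contradiction pk'≡pk pk'≢pk
    ... | inj₂ (inj₁ (_ , _ , pk'≡pk)) = contradiction pk'≡pk pk'≢pk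
    ... | inj₂ (inj₂ move)              = move

    flag-change : ∀ k → mv C' k ≡ mv C k ⊎ mv C' k ≡ married C k
    flag-change k with transition k
    ... | inj₁ (mk'≡mk , _)                                  = inj₁ mk'≡mk
    ... | inj₂ (inj₁ (_ , (to , from) , _))                  = inj₂ (reflects-married C k _ to from)
    ... | inj₂ (inj₂ (inj₁ (_ , _ , mk'≡mk , _)))            = inj₁ mk'≡mk
    ... | inj₂ (inj₂ (inj₂ (inj₁ (_ , _ , _ , mk'≡mk , _)))) = inj₁ mk'≡mk
    ... | inj₂ (inj₂ (inj₂ (inj₂ (_ , mk'≡mk , _))))         = inj₁ mk'≡mk

    reciprocated-pointer-fixed : ∀ {i j} → pv C i ≡ just j → pv C j ≡ just i → pv C' i ≡ just j
    reciprocated-pointer-fixed {i} pi≡j pj≡i with pv C' i ≟ᵖ pv C i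
    ... | yes pi'≡pi = trans pi'≡pi pi≡j
    ... | no pi'≢pi with pointer-moved pi'≢pi
    ...   | inj₁ (_ , pi≡∅ , _)        = contradiction pi≡j (≡nothing⇒≢just pi≡∅)
    ...   | inj₂ (inj₁ (_ , pi≡∅ , _)) = contradiction pi≡j (≡nothing⇒≢just pi≡∅)
    ...   | inj₂ (inj₂ (_ , _ , _ , k , pi≡k , pk≢i , _))
            with just-injective (trans (sym pi≡k) pi≡j)
    ...     | refl = contradiction pj≡i pk≢i

    married-persists : ∀ k → married C k ≡ true → married C' k ≡ true
    married-persists k Mk with married⇒PRmarried C k Mk
    ... | j , adj-kj , pk≡j , pj≡k = PRmarried⇒married C' k
      (j , adj-kj , reciprocated-pointer-fixed pk≡j pj≡k , reciprocated-pointer-fixed pj≡k pk≡j)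

    flag-raised⇒was-set : ∀ k → married C' k ≡ false → mv C' k ≡ true → mv C k ≡ true
    flag-raised⇒was-set k M'k≡f m'k≡t with flag-change k
    ... | inj₁ mk'≡mk = trans (sym mk'≡mk) m'k≡t
    ... | inj₂ mk'≡Mk =
      contradiction (trans (sym M'k≡f) (married-persists k (trans (sym mk'≡Mk) m'k≡t))) λ ()

    flag-stays-false : ∀ {k} → mv C k ≡ false → married C k ≡ false → mv C' k ≡ false
    flag-stays-false {k} mk≡f Mk≡f with flag-change k
    ... | inj₁ mk'≡mk = trans mk'≡mk mk≡f
    ... | inj₂ mk'≡Mk = trans mk'≡Mk Mk≡f

    pointing-starts : ∀ {i j} → pv C i ≢ just j → pv C' i ≡ just j →
      Adj adj i j × married C i ≡ false × mv C i ≡ false ×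
      (pv C j ≡ just i ⊎ married C j ≡ false × mv C j ≡ false × ident i < ident j)
    pointing-starts {i} pi≢j pi'≡j with pointer-moved (λ pi'≡pi → pi≢j (trans (sym pi'≡pi) pi'≡j))
    ... | inj₁ (agree , pi≡∅ , _ , k , adj-ik , pk≡i , pi'≡k)
          with just-injective (trans (sym pi'≡k) pi'≡j)
    ...   | refl = adj-ik , unmarried , trans (agree⇒flag≡married C i agree) unmarried , inj₁ pk≡i
      where unmarried = unpointing⇒unmarried C i pi≡∅
    pointing-starts {i} pi≢j pi'≡j
        | inj₂ (inj₁ (agree , pi≡∅ , _ , _ , k , (adj-ik , pk≡∅ , i<k , mk≡f) , _ , pi'≡k))
          with just-injective (trans (sym pi'≡k) pi'≡j)
    ...   | refl = adj-ik , unmarried , trans (agree⇒flag≡married C i agree) unmarried ,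
                   inj₂ (unpointing⇒unmarried C k pk≡∅ , mk≡f , i<k)
      where unmarried = unpointing⇒unmarried C i pi≡∅
    pointing-starts pi≢j pi'≡j | inj₂ (inj₂ (_ , _ , pi'≡∅ , _)) =
      contradiction pi'≡j (≡nothing⇒≢just pi'≡∅)

    pointing-stops : ∀ {i j} → pv C i ≡ just j → pv C' i ≢ just j →
      pv C j ≢ just i × mv C i ≡ false × (mv C j ≡ true ⊎ ident j ≤ ident i)
    pointing-stops {i} pi≡j pi'≢j with pointer-moved (λ pi'≡pi → pi'≢j (trans pi'≡pi pi≡j))
    ... | inj₁ (_ , pi≡∅ , _)        = contradiction pi≡j (≡nothing⇒≢just pi≡∅)
    ... | inj₂ (inj₁ (_ , pi≡∅ , _)) = contradiction pi≡j (≡nothing⇒≢just pi≡∅)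
    ... | inj₂ (inj₂ (agree , _ , _ , k , pi≡k , pk≢i , condition))
          with just-injective (trans (sym pi≡k) pi≡j)
    ...   | refl = pk≢i , trans (agree⇒flag≡married C i agree) (one-sided⇒unmarried C i pi≡k pk≢i) ,
                   condition

    pointerPotAt-moved : ∀ {k} → pv C' k ≢ pv C k → pointerPotAt C' k ≡ 0
    pointerPotAt-moved {k} pk'≢pk = via (pv C' k) refl
      where
      via : ∀ q → pv C' k ≡ q → pointerPotAt C' k ≡ 0
      via nothing  pk'≡∅ = cong (pointerPotVia C' k) pk'≡∅
      via (just j) pk'≡j with pointing-starts (λ pk≡j → pk'≢pk (trans pk'≡j (sym pk≡j))) pk'≡j
      ... | _ , _ , _ , inj₂ (Mj≡f , mj≡f , k<j) =
        pointerPotAt-idle C' pk'≡j (<⇒≤ k<j) (flag-stays-false mj≡f Mj≡f)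
      ... | adj-kj , _ , mk≡f , inj₁ pj≡k with pv C' j ≟ᵖ just k
      ...   | yes pj'≡k =
        pointerPotAt-married C' k (PRmarried⇒married C' k (j , adj-kj , pk'≡j , pj'≡k))
      ...   | no pj'≢k with pointing-stops pj≡k pj'≢k
      ...     | _ , _ , inj₁ mk≡t = contradiction (trans (sym mk≡f) mk≡t) λ ()
      ...     | pk≢j , mj≡f , inj₂ k≤j =
        pointerPotAt-idle C' pk'≡j k≤j (flag-stays-false mj≡f (one-sided⇒unmarried C j pj≡k pk≢j))

    pointerPotAt-mono : ∀ k → pointerPotAt C' k ≤ pointerPotAt C k
    pointerPotAt-mono k with pv C' k ≟ᵖ pv C k
    ... | no pk'≢pk = subst (_≤ pointerPotAt C k) (sym (pointerPotAt-moved pk'≢pk)) z≤n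
    ... | yes pk'≡pk = via (pv C k) refl
      where
      via : ∀ q → pv C k ≡ q → pointerPotAt C' k ≤ pointerPotAt C k
      via nothing pk≡∅ =
        subst (_≤ pointerPotAt C k) (sym (cong (pointerPotVia C' k) (trans pk'≡pk pk≡∅))) z≤n
      via (just j) pk≡j =
        subst₂ _≤_ (sym (pointerPotAt-just C' (trans pk'≡pk pk≡j))) (sym (pointerPotAt-just C pk≡j))
               (pointerPot-step _ _ _ _ _ _ _
                  (married-persists k) (married-persists j) (flag-raised⇒was-set j))

    flagPotAt-step : ∀ k → flagPotAt C' k ≤ flagPotAt C k ×
                           (mv C' k ≢ mv C k → flagPotAt C' k < flagPotAt C k)
    flagPotAt-step k = flagPot-step _ _ _ _ (married-persists k) (flag-change k)

    nodePot-mono : ∀ k → nodePot C' k ≤ nodePot C k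
    nodePot-mono k = +-mono-≤ (proj₁ (flagPotAt-step k)) (pointerPotAt-mono k)

    edgePotAt-step : ∀ {lo hi} → ident lo < ident hi →
      edgePotAt C' lo hi ≤ edgePotAt C lo hi ×
      (EdgeProgress (points C lo hi) (points C hi lo) (married C hi)
                    (points C' lo hi) (points C' hi lo) →
       edgePotAt C' lo hi < edgePotAt C lo hi)
    edgePotAt-step {lo} {hi} lo<hi =
      edgePot-step _ _ _ _ _ _ _ _ _ _
        (married-persists lo) (married-persists hi) (flag-raised⇒was-set hi)
        low-starts low-stops high-starts high-stops
      where
      low-starts : points C lo hi ≡ false → points C' lo hi ≡ true → married C lo ≡ false ×
                   (points C hi lo ≡ true ⊎ married C hi ≡ false × mv C hi ≡ false)
      low-starts a≡f a'≡t
        with pointing-starts (¬points⇒≢just C lo hi a≡f) (points⇒≡just C' lo hi a'≡t)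
      ... | _ , Ml≡f , _ , inj₁ ph≡lo               = Ml≡f , inj₁ (≡just⇒points C hi lo ph≡lo)
      ... | _ , Ml≡f , _ , inj₂ (Mh≡f , mh≡f , _) = Ml≡f , inj₂ (Mh≡f , mh≡f)

      low-stops : points C lo hi ≡ true → points C' lo hi ≡ false →
                  points C hi lo ≡ false × mv C hi ≡ true
      low-stops a≡t a'≡f
        with pointing-stops (points⇒≡just C lo hi a≡t) (¬points⇒≢just C' lo hi a'≡f)
      ... | ph≢lo , _ , inj₁ mh≡t = ≢just⇒¬points C hi lo ph≢lo , mh≡t
      ... | _ , _ , inj₂ hi≤lo    = contradiction lo<hi (≤⇒≯ hi≤lo)

      high-starts : points C hi lo ≡ false → points C' hi lo ≡ true →
                    points C lo hi ≡ true × mv C hi ≡ false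
      high-starts b≡f b'≡t
        with pointing-starts (¬points⇒≢just C hi lo b≡f) (points⇒≡just C' hi lo b'≡t)
      ... | _ , _ , mh≡f , inj₁ pl≡hi           = ≡just⇒points C lo hi pl≡hi , mh≡f
      ... | _ , _ , _ , inj₂ (_ , _ , hi<lo) = contradiction lo<hi (<⇒≯ hi<lo)

      high-stops : points C hi lo ≡ true → points C' hi lo ≡ false →
                   points C lo hi ≡ false × mv C hi ≡ false
      high-stops b≡t b'≡f
        with pointing-stops (points⇒≡just C hi lo b≡t) (¬points⇒≢just C' hi lo b'≡f)
      ... | pl≢hi , mh≡f , _ = ≢just⇒¬points C lo hi pl≢hi , mh≡f

    orientedEdgePot-mono : ∀ p → orientedEdgePot C' p ≤ orientedEdgePot C p
    orientedEdgePot-mono (x , y) with <-cmp (ident x) (ident y)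
    ... | tri< x<y _ _ = proj₁ (edgePotAt-step x<y)
    ... | tri≈ _ _ _   = z≤n
    ... | tri> _ _ y<x = proj₁ (edgePotAt-step y<x)

    nodePot<⇒potential< : ∀ {k} → nodePot C' k < nodePot C k → potential C' < potential C
    nodePot<⇒potential< {k} lt = +-mono-<-≤
      (sum-map-mono-< (nodePot C') (nodePot C) (allFin n) nodePot-mono (∈-allFin k) lt)
      (sum-map-mono (orientedEdgePot C') (orientedEdgePot C) edges orientedEdgePot-mono)

    pointer-dropped⇒potential< : ∀ {k} → pv C' k ≡ nothing → pointerPotAt C k ≡ 1 →
                                 potential C' < potential C
    pointer-dropped⇒potential< {k} pk'≡∅ charged = nodePot<⇒potential< (+-mono-≤-<
      (proj₁ (flagPotAt-step k))
      (subst₂ _<_ (sym (cong (pointerPotVia C' k) pk'≡∅)) (sym charged) (s≤s z≤n)))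

    edgePotAt<⇒potential< : (∀ i j → adj i j ≡ adj j i) → ∀ {lo hi} → Adj adj lo hi →
      ident lo < ident hi → edgePotAt C' lo hi < edgePotAt C lo hi → potential C' < potential C
    edgePotAt<⇒potential< symmetric adj-lh lo<hi lt with edge-listed symmetric adj-lh lo<hi
    ... | p , p∈edges , p-pot = +-mono-≤-<
      (sum-map-mono (nodePot C') (nodePot C) (allFin n) nodePot-mono)
      (sum-map-mono-< (orientedEdgePot C') (orientedEdgePot C) edges orientedEdgePot-mono p∈edges
                      (subst₂ _<_ (sym (p-pot C')) (sym (p-pot C)) lt))

    module _ (symmetric : ∀ i j → adj i j ≡ adj j i)
             (distinct : ∀ i j → Adj adj i j → ident i ≢ ident j) where

      pointing-starts⇒potential< : ∀ {i j} → Adj adj i j → pv C i ≢ just j → pv C' i ≡ just j →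
                                   potential C' < potential C
      pointing-starts⇒potential< {i} {j} adj-ij pi≢j pi'≡j with <-cmp (ident i) (ident j)
      ... | tri< i<j _ _ = edgePotAt<⇒potential< symmetric adj-ij i<j
        (proj₂ (edgePotAt-step i<j) (inj₁ (≢just⇒¬points C i j pi≢j , ≡just⇒points C' i j pi'≡j)))
      ... | tri≈ _ i≡j _ = contradiction i≡j (distinct i j adj-ij)
      ... | tri> _ _ j<i = edgePotAt<⇒potential< symmetric (trans (symmetric j i) adj-ij) j<i
        (proj₂ (edgePotAt-step j<i)
               (inj₂ (inj₂ (≢just⇒¬points C i j pi≢j , ≡just⇒points C' i j pi'≡j))))

      abandonment⇒potential< : WellFormed adj C → ∀ {i j} → pv C i ≡ just j → pv C j ≢ just i →
        mv C j ≡ true ⊎ ident j ≤ ident i → pv C' i ≡ nothing → potential C' < potential C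
      abandonment⇒potential< wf {i} {j} pi≡j pj≢i condition pi'≡∅ with <-cmp (ident i) (ident j)
      ... | tri> _ _ j<i = pointer-dropped⇒potential< pi'≡∅
        (pointerPotAt-towardsLower C pi≡j (one-sided⇒unmarried C i pi≡j pj≢i) j<i)
      ... | tri≈ _ i≡j _ = contradiction i≡j (distinct i j (wf i j pi≡j))
      ... | tri< i<j _ _ with condition
      ...   | inj₂ j≤i = contradiction i<j (≤⇒≯ j≤i)
      ...   | inj₁ mj≡t with married C j in Mj
      ...     | true = edgePotAt<⇒potential< symmetric (wf i j pi≡j) i<j
        (proj₂ (edgePotAt-step i<j)
               (inj₂ (inj₁ ( ≡just⇒points C i j pi≡j
                           , ≢just⇒¬points C' i j (≡nothing⇒≢just pi'≡∅) , Mj))))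
      ...     | false = pointer-dropped⇒potential< pi'≡∅
        (pointerPotAt-towardsFlagged C pi≡j (one-sided⇒unmarried C i pi≡j pj≢i) (<⇒≤ i<j) Mj mj≡t)

      move⇒potential< : WellFormed adj C → ∀ {i} → Move C i (mv C' i) (pv C' i) →
                        potential C' < potential C
      move⇒potential< _ {i} (inj₁ (disagree , (to , from) , _)) = nodePot<⇒potential<
        (+-mono-<-≤ (proj₂ (flagPotAt-step i) flag-corrected) (pointerPotAt-mono i))
        where
        flag-corrected : mv C' i ≢ mv C i
        flag-corrected mi'≡mi = disagree⇒flag≢married C i disagree
          (trans (sym mi'≡mi) (reflects-married C i (mv C' i) to from))
      move⇒potential< _ (inj₂ (inj₁ (_ , pi≡∅ , _ , j , adj-ij , _ , pi'≡j))) =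
        pointing-starts⇒potential< adj-ij (≡nothing⇒≢just pi≡∅) pi'≡j
      move⇒potential< _ (inj₂ (inj₂ (inj₁ (_ , pi≡∅ , _ , _ , j , (adj-ij , _) , _ , pi'≡j)))) =
        pointing-starts⇒potential< adj-ij (≡nothing⇒≢just pi≡∅) pi'≡j
      move⇒potential< wf (inj₂ (inj₂ (inj₂ (_ , _ , pi'≡∅ , j , pi≡j , pj≢i , condition)))) =
        abandonment⇒potential< wf pi≡j pj≢i condition pi'≡∅

  step⇒potential< : SimpleGraph adj → LocallyDistinctIds adj ident → ∀ {C C'} →
                    WellFormed adj C → Step C C' → potential C' < potential C
  step⇒potential< (symmetric , _) (distinct , _) wf step@(_ , (i , i-moves) , moves , _) =
    StepFacts.move⇒potential< (step⇒transition step) symmetric distinct wf (moves i i-moves)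

  wellFormed-along : ∀ {e} → IsExecution e → ∀ t → WellFormed adj (e t)
  wellFormed-along (wf₀ , _) zero = wf₀
  wellFormed-along execution@(_ , next) (suc t) with next t
  ... | inj₁ step       = step-preserves-wellFormed step (wellFormed-along execution t)
  ... | inj₂ (_ , same) = λ i j pi≡j →
    wellFormed-along execution t i j (trans (sym (proj₂ (same i))) pi≡j)

theorem2 : (n : ℕ) (adj : Fin n → Fin n → Bool) (ident : Fin n → ℕ) →
    SimpleGraph adj → LocallyDistinctIds adj ident →
    (e : ℕ → Config n) → Algorithm.IsExecution adj ident e →
    ∃ λ t → t ≤ 3 * n + 2 * numEdges adj × Algorithm.Stable adj ident (e t)
theorem2 n adj ident simple distinct e execution =
  let t , t≤Φ₀ , stable = reaches-within-potential (potential ∘ e) (Stable ∘ e) stable-or-descends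
  in  t , ≤-trans t≤Φ₀ (potential≤ (e 0)) , stable
  where
  open Algorithm adj ident
  open Matching adj ident

  stable-or-descends : ∀ t → Stable (e t) ⊎ potential (e (suc t)) < potential (e t)
  stable-or-descends t with proj₂ execution t
  ... | inj₁ step =
    inj₂ (step⇒potential< simple distinct (wellFormed-along execution t) step)
  ... | inj₂ (stable , _) = inj₁ stable
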